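{- For every finite simple graph $G=(V,E)$ with at least three vertices and no isolated vertices, $|E(G)|\le h(G)\le 2|E(G)|$.
   Context: A directed 3-hypergraph $H=(V,F)$ consists of hyperarcs $u,v\to w$ (body $\{u,v\}$ of two distinct vertices, head $w$). The closure $cl_H(S)$ of $S\subseteq V$ is obtained by forward chaining: mark $S$; while some hyperarc $a,b\to c$ has $a,b$ marked and $c$ unmarked, mark $c$. $H$ represents $G=(V,E)$ if for all distinct $u,v$: $(u,v)\in E\Rightarrow cl_H(\{u,v\})=V$ and $(u,v)\notin E\Rightarrow cl_H(\{u,v\})=\{u,v\}$. The hydra number $h(G)$ is the minimum number of hyperarcs of a directed 3-hypergraph on $V$ representing $G$. -}

module Defs where

open import Data.Nat using (ℕ; _≤_)
open import Data.Fin using (Fin; _<_)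
open import Data.Fin.Properties using (_<?_)
open import Data.Bool using (Bool; true; false; T)
open import Data.Bool.Properties using (T?)
open import Data.List using (List; length; filter; allFin; cartesianProduct)
open import Data.List.Membership.Propositional using (_∈_)
open import Data.Product using (_×_; _,_; ∃)
open import Data.Sum using (_⊎_)
open import Relation.Binary.PropositionalEquality using (_≡_; _≢_)
open import Relation.Nullary.Decidable using (_×-dec_)

record Graph (n : ℕ) : Set where
  field
    adj   : Fin n → Fin n → Bool
    sym   : ∀ u v → adj u v ≡ adj v u
    irrefl : ∀ v → adj v v ≡ false
open Graph public

edges : ∀ {n} → Graph n → List (Fin n × Fin n)
edges {n} G = filter (λ p → let (i , j) = p in (i <? j) ×-dec T? (adj G i j))
                     (cartesianProduct (allFin n) (allFin n))

edgeCount : ∀ {n} → Graph n → ℕ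
edgeCount G = length (edges G)

NoIsolated : ∀ {n} → Graph n → Set
NoIsolated {n} G = ∀ (v : Fin n) → ∃ λ (u : Fin n) → adj G v u ≡ true

record Hyperarc (n : ℕ) : Set where
  constructor _,_⇒_∣_
  field
    tail₁ tail₂ : Fin n
    head        : Fin n
    distinct    : tail₁ ≢ tail₂
open Hyperarc public

Hypergraph : ℕ → Set
Hypergraph n = List (Hyperarc n)

-- Closure cl_H(S) by forward chaining, as the inductively generated
-- (least) set containing S and closed under the hyperarcs of H.
data Closure {n : ℕ} (H : Hypergraph n) (S : Fin n → Set) : Fin n → Set where
  base  : ∀ {x} → S x → Closure H S x
  chain : ∀ (e : Hyperarc n) → e ∈ H →
          Closure H S (tail₁ e) → Closure H S (tail₂ e) →
          Closure H S (head e)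

Pair : ∀ {n} → Fin n → Fin n → Fin n → Set
Pair u v w = w ≡ u ⊎ w ≡ v

Represents : ∀ {n} → Hypergraph n → Graph n → Set
Represents {n} H G = ∀ (u v : Fin n) → u ≢ v →
  (adj G u v ≡ true  → ∀ w → Closure H (Pair u v) w) ×
  (adj G u v ≡ false → ∀ w → Closure H (Pair u v) w → Pair u v w)

IsHydraNumber : ∀ {n} → Graph n → ℕ → Set
IsHydraNumber {n} G k =
  (∃ λ (H : Hypergraph n) → Represents H G × length H ≡ k) ×
  (∀ (H : Hypergraph n) → Represents H G → k ≤ length H)

-- Lower bound: if uv is an edge, the closure of {u, v} reaches a third vertex,
-- and forward chaining can only leave {u, v} through a hyperarc with body
-- {u, v}; so every edge is the body of a hyperarc. Upper bound: list the edges
-- e₁, …, eₘ cyclically and add the two hyperarcs eᵢ → each endpoint of eᵢ₊₁.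
-- The closure of any edge then runs around the whole cycle and, as no vertex
-- is isolated, covers V, while the closure of a non-edge cannot fire any
-- hyperarc. The minimum defining h(G) exists because representability by k
-- hyperarcs is decidable: a closure is computed by saturating a subset of V.
module Submission where

open import Defs hiding (sym)
open import Data.Bool using (true; false; T)
open import Data.Bool.Properties using (T?; T-≡) renaming (_≟_ to _≟ᵇ_)
open import Data.Empty using (⊥-elim)
open import Data.Fin using (Fin; zero; suc; _<_)
open import Data.Fin.Properties using (_≟_; _<?_; <-cmp; <⇒≢; <-asym; any?; all?)
open import Data.Fin.Subset using (Subset; ⁅_⁆; _∪_; ∣_∣; ∁; _⊂_; _⊃_)
  renaming (_∈_ to _∈ₛ_; _∉_ to _∉ₛ_; _⊆_ to _⊆ₛ_)
open import Data.Fin.Subset.Properties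
  using (_∈?_; p⊂q⇒∣p∣<∣q∣; p⊂q⇒∁p⊃∁q; p⊆p∪q; q⊆p∪q; x∈p∪q⁻; x∈⁅x⁆; x∈⁅y⁆⇒x≡y)
open import Data.List using (List; []; _∷_; _∷ʳ_; length; map; allFin; cartesianProduct)
open import Data.List.Properties using (length-map; length-++; length-removeAt′)
open import Data.List.Membership.Propositional using (_∈_; find; lose)
open import Data.List.Membership.Propositional.Properties
  using (∈-map⁺; ∈-map⁻; ∈-++⁻; ∈-filter⁺; ∈-filter⁻; ∈-allFin; ∈-cartesianProduct⁺)
open import Data.List.Relation.Unary.All as All using (All; []; _∷_)
open import Data.List.Relation.Unary.All.Properties using (++⁻ˡ)
open import Data.List.Relation.Unary.Any as Any using (Any; here; there; _─_)
open import Data.List.Relation.Unary.Any.Properties using (++⁺ˡ)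
open import Data.List.Relation.Unary.Linked using (Linked; []; [-]; _∷_)
open import Data.List.Relation.Unary.Unique.Propositional using (Unique; _∷_)
open import Data.List.Relation.Unary.Unique.Propositional.Properties
  using (filter⁺; cartesianProduct⁺; allFin⁺)
open import Data.Nat using (ℕ; _≤_; _*_; _+_; z≤n; s≤s) renaming (_<_ to _<ℕ_)
open import Data.Nat.Induction using (<-wellFounded)
open import Data.Nat.Properties
  using ( ≤-trans; ≤-reflexive; ≤-antisym; n≤1+n; ≮⇒≥; n<1+n; m<1+n⇒m<n∨m≡n
        ; suc-injective; +-comm; *-suc)
open import Data.Product using (_×_; _,_; ∃; proj₁; proj₂)
open import Data.Sum using (_⊎_; inj₁; inj₂; [_,_]′)
import Data.Sum as Sum
open import Function using (_∘_; id)
open import Function.Bundles using (Equivalence)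
open import Induction.WellFounded using (WellFounded; Acc; acc; module Subrelation)
import Relation.Binary.Construct.On as On
open import Relation.Binary using (tri<; tri≈; tri>)
open import Relation.Binary.PropositionalEquality
  using (_≡_; _≢_; refl; sym; trans; cong; subst)
open import Relation.Nullary using (Dec; yes; no; ¬_; ¬?)
open import Relation.Nullary.Decidable using (map′; _×-dec_; _⊎-dec_; _→-dec_)
open import Relation.Unary using (Decidable)

Triple : ℕ → Set
Triple n = Fin n × Fin n × Fin n

module _ {n : ℕ} where

  HasArc : Hypergraph n → Fin n → Fin n → Fin n → Set
  HasArc H a b c = ∃ λ e → e ∈ H × tail₁ e ≡ a × tail₂ e ≡ b × head e ≡ c

  _⊑_ : Hypergraph n → Hypergraph n → Set
  H ⊑ H′ = ∀ {e} → e ∈ H → HasArc H′ (tail₁ e) (tail₂ e) (head e)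

  chain-HasArc : ∀ {H S a b c} → HasArc H a b c →
                 Closure H S a → Closure H S b → Closure H S c
  chain-HasArc (e , e∈H , refl , refl , refl) = chain e e∈H

  Closure-mono : ∀ {H H′ S x} → H ⊑ H′ → Closure H S x → Closure H′ S x
  Closure-mono H⊑H′ (base s)            = base s
  Closure-mono H⊑H′ (chain e e∈H c₁ c₂) =
    chain-HasArc (H⊑H′ e∈H) (Closure-mono H⊑H′ c₁) (Closure-mono H⊑H′ c₂)

  Represents-resp-⊑ : ∀ {H H′ G} → H ⊑ H′ → H′ ⊑ H → Represents H G → Represents H′ G
  Represents-resp-⊑ H⊑H′ H′⊑H rep u v u≢v =
    (λ uv w → Closure-mono H⊑H′ (proj₁ (rep u v u≢v) uv w)) ,
    (λ uv w c → proj₂ (rep u v u≢v) uv w (Closure-mono H′⊑H c))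

  arcsOf : List (Triple n) → Hypergraph n
  arcsOf [] = []
  arcsOf ((a , b , c) ∷ ts) with a ≟ b
  ... | yes _   = arcsOf ts
  ... | no a≢b = (a , b ⇒ c ∣ a≢b) ∷ arcsOf ts

  triple : Hyperarc n → Triple n
  triple e = tail₁ e , tail₂ e , head e

  shape : Hypergraph n → List (Triple n)
  shape = map triple

  length-arcsOf : ∀ ts → length (arcsOf ts) ≤ length ts
  length-arcsOf [] = z≤n
  length-arcsOf ((a , b , c) ∷ ts) with a ≟ b
  ... | yes _ = ≤-trans (length-arcsOf ts) (n≤1+n _)
  ... | no _  = s≤s (length-arcsOf ts)

  ∈-arcsOf⁺ : ∀ {ts a b c} → (a , b , c) ∈ ts → a ≢ b → HasArc (arcsOf ts) a b c
  ∈-arcsOf⁺ {(a , b , c) ∷ ts} t∈ a≢b with a ≟ b | t∈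
  ... | yes a≡b | here refl = ⊥-elim (a≢b a≡b)
  ... | yes _   | there t∈ts = ∈-arcsOf⁺ t∈ts a≢b
  ... | no _    | here refl = _ , here refl , refl , refl , refl
  ... | no _    | there t∈ts =
    let e , e∈ , eqs = ∈-arcsOf⁺ t∈ts a≢b in e , there e∈ , eqs

  ∈-arcsOf⁻ : ∀ {ts e} → e ∈ arcsOf ts → triple e ∈ ts
  ∈-arcsOf⁻ {(a , b , c) ∷ ts} e∈ with a ≟ b | e∈
  ... | yes _ | e∈ts        = there (∈-arcsOf⁻ e∈ts)
  ... | no _  | here refl   = here refl
  ... | no _  | there e∈ts  = there (∈-arcsOf⁻ e∈ts)

  ⊑-arcsOf-shape : ∀ H → H ⊑ arcsOf (shape H)
  ⊑-arcsOf-shape H {e} e∈H = ∈-arcsOf⁺ (∈-map⁺ triple e∈H) (distinct e)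

  arcsOf-shape-⊑ : ∀ H → arcsOf (shape H) ⊑ H
  arcsOf-shape-⊑ H e∈ with ∈-map⁻ triple (∈-arcsOf⁻ {shape H} e∈)
  ... | e′ , e′∈H , refl = e′ , e′∈H , refl , refl , refl

  Pair-distinct : ∀ {u v a b : Fin n} → Pair u v a → Pair u v b → a ≢ b →
                  (a ≡ u × b ≡ v) ⊎ (a ≡ v × b ≡ u)
  Pair-distinct (inj₁ a≡u) (inj₁ b≡u) a≢b = ⊥-elim (a≢b (trans a≡u (sym b≡u)))
  Pair-distinct (inj₁ a≡u) (inj₂ b≡v) _   = inj₁ (a≡u , b≡v)
  Pair-distinct (inj₂ a≡v) (inj₁ b≡u) _   = inj₂ (a≡v , b≡u)
  Pair-distinct (inj₂ a≡v) (inj₂ b≡v) a≢b = ⊥-elim (a≢b (trans a≡v (sym b≡v)))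

  Closure-Pair⁻ : ∀ {H} {u v w : Fin n} → Closure H (Pair u v) w →
                  Pair u v w ⊎ ∃ λ e → e ∈ H × Pair u v (tail₁ e) × Pair u v (tail₂ e)
  Closure-Pair⁻ (base w∈uv) = inj₁ w∈uv
  Closure-Pair⁻ (chain e e∈H c₁ c₂) with Closure-Pair⁻ c₁ | Closure-Pair⁻ c₂
  ... | inj₁ t₁∈uv | inj₁ t₂∈uv = inj₂ (e , e∈H , t₁∈uv , t₂∈uv)
  ... | inj₂ arc   | _          = inj₂ arc
  ... | inj₁ _     | inj₂ arc   = inj₂ arc

⊃-wellFounded : ∀ {n} → WellFounded (_⊃_ {n})
⊃-wellFounded = Subrelation.wellFounded (λ p⊂q → p⊂q⇒∣p∣<∣q∣ (p⊂q⇒∁p⊃∁q p⊂q))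
                                        (On.wellFounded (∣_∣ ∘ ∁) <-wellFounded)

module Saturation {n : ℕ} (H : Hypergraph n) (S : Fin n → Set) where

  Sound : Subset n → Set
  Sound p = ∀ {x} → x ∈ₛ p → Closure H S x

  Closed : Subset n → Set
  Closed p = ∀ {e} → e ∈ H → tail₁ e ∈ₛ p → tail₂ e ∈ₛ p → head e ∈ₛ p

  Closure⊆closed : ∀ {p} → (∀ {x} → S x → x ∈ₛ p) → Closed p →
                   ∀ {x} → Closure H S x → x ∈ₛ p
  Closure⊆closed S⊆p closed (base s)            = S⊆p s
  Closure⊆closed S⊆p closed (chain e e∈H c₁ c₂) =
    closed e∈H (Closure⊆closed S⊆p closed c₁) (Closure⊆closed S⊆p closed c₂)

  Fires : Subset n → Hyperarc n → Set
  Fires p e = tail₁ e ∈ₛ p × tail₂ e ∈ₛ p × head e ∉ₛ p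

  fires? : ∀ p → Decidable (Fires p)
  fires? p e = (tail₁ e ∈? p) ×-dec (tail₂ e ∈? p) ×-dec ¬? (head e ∈? p)

  ¬Fires⇒Closed : ∀ {p} → ¬ Any (Fires p) H → Closed p
  ¬Fires⇒Closed {p} ¬fires {e} e∈H t₁∈p t₂∈p with head e ∈? p
  ... | yes h∈p = h∈p
  ... | no h∉p  = ⊥-elim (¬fires (lose e∈H (t₁∈p , t₂∈p , h∉p)))

  fire : ∀ {p e} → e ∈ H → Fires p e → Sound p →
         p ⊂ p ∪ ⁅ head e ⁆ × Sound (p ∪ ⁅ head e ⁆)
  fire {p} {e} e∈H (t₁∈p , t₂∈p , h∉p) sound =
    (p⊆p∪q ⁅ head e ⁆ , head e , q⊆p∪q p ⁅ head e ⁆ (x∈⁅x⁆ (head e)) , h∉p) , sound′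
    where
    sound′ : Sound (p ∪ ⁅ head e ⁆)
    sound′ x∈ with x∈p∪q⁻ p ⁅ head e ⁆ x∈
    ... | inj₁ x∈p = sound x∈p
    ... | inj₂ x∈h with x∈⁅y⁆⇒x≡y (head e) x∈h
    ...   | refl = chain e e∈H (sound t₁∈p) (sound t₂∈p)

  saturate : ∀ p → Acc _⊃_ p → Sound p → ∃ λ q → p ⊆ₛ q × Sound q × Closed q
  saturate p (acc rs) sound with Any.any? (fires? p) H
  ... | no ¬fires = p , id , sound , ¬Fires⇒Closed ¬fires
  ... | yes fires =
    let e , e∈H , fe        = find fires
        p⊂p′ , sound′        = fire e∈H fe sound
        q , p′⊆q , sound-q , closed-q = saturate _ (rs p⊂p′) sound′
    in q , (λ x∈p → p′⊆q (proj₁ p⊂p′ x∈p)) , sound-q , closed-q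

  closure? : (s : Subset n) → (∀ {x} → S x → x ∈ₛ s) → Sound s → Decidable (Closure H S)
  closure? s S⊆s sound x with saturate s (⊃-wellFounded s) sound
  ... | q , s⊆q , sound-q , closed-q =
    map′ sound-q (Closure⊆closed (s⊆q ∘ S⊆s) closed-q) (x ∈? q)

module _ {n : ℕ} where

  Pair? : ∀ (u v : Fin n) → Decidable (Pair u v)
  Pair? u v w = (w ≟ u) ⊎-dec (w ≟ v)

  Closure-Pair? : ∀ (H : Hypergraph n) u v → Decidable (Closure H (Pair u v))
  Closure-Pair? H u v = closure? (⁅ u ⁆ ∪ ⁅ v ⁆) Pair⊆ sound
    where
    open Saturation H (Pair u v)
    Pair⊆ : ∀ {x} → Pair u v x → x ∈ₛ ⁅ u ⁆ ∪ ⁅ v ⁆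
    Pair⊆ (inj₁ refl) = p⊆p∪q ⁅ v ⁆ (x∈⁅x⁆ u)
    Pair⊆ (inj₂ refl) = q⊆p∪q ⁅ u ⁆ ⁅ v ⁆ (x∈⁅x⁆ v)
    sound : Sound (⁅ u ⁆ ∪ ⁅ v ⁆)
    sound x∈ = base (Sum.map (x∈⁅y⁆⇒x≡y u) (x∈⁅y⁆⇒x≡y v) (x∈p∪q⁻ ⁅ u ⁆ ⁅ v ⁆ x∈))

  represents? : ∀ (H : Hypergraph n) G → Dec (Represents H G)
  represents? H G = all? λ u → all? λ v → ¬? (u ≟ v) →-dec
    (((adj G u v ≟ᵇ true) →-dec all? (Closure-Pair? H u v)) ×-dec
     ((adj G u v ≟ᵇ false) →-dec all? λ w → Closure-Pair? H u v w →-dec Pair? u v w))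

Exhaustible : Set → Set₁
Exhaustible A = ∀ {P : A → Set} → Decidable P → Dec (∃ P)

×-exhaustible : ∀ {A B} → Exhaustible A → Exhaustible B → Exhaustible (A × B)
×-exhaustible ∃A? ∃B? P? =
  map′ (λ (a , b , p) → (a , b) , p) (λ ((a , b) , p) → a , b , p)
       (∃A? λ a → ∃B? λ b → P? (a , b))

∃-ofLength? : ∀ {A} → Exhaustible A → ∀ k {P : List A → Set} → Decidable P →
              Dec (∃ λ xs → length xs ≡ k × P xs)
∃-ofLength? ∃A? ℕ.zero P? =
  map′ (λ p → [] , refl , p) (λ { ([] , _ , p) → p ; (_ ∷ _ , () , _) }) (P? [])
∃-ofLength? ∃A? (ℕ.suc k) P? =
  map′ (λ (x , xs , len , p) → x ∷ xs , cong ℕ.suc len , p)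
       (λ { (x ∷ xs , len , p) → x , xs , suc-injective len , p })
       (∃A? λ x → ∃-ofLength? ∃A? k λ xs → P? (x ∷ xs))

module _ {Q : ℕ → Set} (Q? : Decidable Q) where

  Least : ℕ → Set
  Least m = Q m × (∀ {j} → Q j → m ≤ j)

  least-or-none-below : ∀ k → ∃ Least ⊎ (∀ {j} → j <ℕ k → ¬ Q j)
  least-or-none-below ℕ.zero = inj₂ λ ()
  least-or-none-below (ℕ.suc k) with least-or-none-below k | Q? k
  ... | inj₁ least | _      = inj₁ least
  ... | inj₂ none  | yes qk = inj₁ (k , qk , λ qj → ≮⇒≥ λ j<k → none j<k qj)
  ... | inj₂ none  | no ¬qk =
    inj₂ λ j<1+k → [ none , (λ { refl → ¬qk }) ]′ (m<1+n⇒m<n∨m≡n j<1+k)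

  least-witness : ∀ {k} → Q k → ∃ Least
  least-witness {k} qk =
    [ id , (λ none → ⊥-elim (none (n<1+n k) qk)) ]′ (least-or-none-below (ℕ.suc k))

module _ {n : ℕ} (G : Graph n) where

  -- Lists of triples rather than of hyperarcs: a hyperarc carries a proof of
  -- tail₁ ≢ tail₂, and such proofs cannot be enumerated.
  RepresentableWith : ℕ → Set
  RepresentableWith k = ∃ λ (ts : List (Triple n)) → length ts ≡ k × Represents (arcsOf ts) G

  representableWith? : Decidable RepresentableWith
  representableWith? k =
    ∃-ofLength? (×-exhaustible any? (×-exhaustible any? any?)) k λ ts → represents? (arcsOf ts) G

  representableWith-length : ∀ {H} → Represents H G → RepresentableWith (length H)
  representableWith-length {H} rep =
    shape H , length-map triple H , Represents-resp-⊑ {G = G} (⊑-arcsOf-shape H) (arcsOf-shape-⊑ H) rep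

  hydraNumber-exists : ∀ {H} → Represents H G → ∃ λ h → IsHydraNumber G h × h ≤ length H
  hydraNumber-exists rep with least-witness representableWith? (representableWith-length rep)
  ... | h , (ts , refl , rep-ts) , minimal =
    h , ((arcsOf ts , rep-ts , ≤-antisym (length-arcsOf ts) (minimal′ rep-ts)) , λ _ → minimal′) ,
    minimal′ rep
    where
    minimal′ : ∀ {H′} → Represents H′ G → length ts ≤ length H′
    minimal′ rep′ = minimal (representableWith-length rep′)

module _ {A : Set} where

  ∈-─⁺ : ∀ {x z} {ys : List A} (x∈ys : x ∈ ys) → z ∈ ys → z ≢ x → z ∈ (ys ─ x∈ys)
  ∈-─⁺ (here refl) (here refl) z≢x = ⊥-elim (z≢x refl)
  ∈-─⁺ (here _)    (there z∈)  _   = z∈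
  ∈-─⁺ (there _)   (here refl) _   = here refl
  ∈-─⁺ (there x∈)  (there z∈)  z≢x = there (∈-─⁺ x∈ z∈ z≢x)

  Unique-⊆⇒length≤ : ∀ {xs ys : List A} → Unique xs → (∀ {z} → z ∈ xs → z ∈ ys) →
                     length xs ≤ length ys
  Unique-⊆⇒length≤ {[]}          _             _     = z≤n
  Unique-⊆⇒length≤ {x ∷ xs} {ys} (x∉xs ∷ uniq) xs⊆ys =
    ≤-trans (s≤s (Unique-⊆⇒length≤ uniq xs⊆ys─x)) (≤-reflexive (sym (length-removeAt′ ys _)))
    where
    x∈ys : x ∈ ys
    x∈ys = xs⊆ys (here refl)
    xs⊆ys─x : ∀ {z} → z ∈ xs → z ∈ (ys ─ x∈ys)
    xs⊆ys─x z∈xs = ∈-─⁺ x∈ys (xs⊆ys (there z∈xs)) (λ z≡x → All.lookup x∉xs z∈xs (sym z≡x))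

  closeLoop : List A → List A
  closeLoop []       = []
  closeLoop (x ∷ xs) = x ∷ xs ∷ʳ x

  ∈-closeLoop⁻ : ∀ {z xs} → z ∈ closeLoop xs → z ∈ xs
  ∈-closeLoop⁻ {xs = x ∷ xs} (here refl) = here refl
  ∈-closeLoop⁻ {xs = x ∷ xs} (there z∈) with ∈-++⁻ xs z∈
  ... | inj₁ z∈xs       = there z∈xs
  ... | inj₂ (here refl) = here refl

  Propagates : (A → Set) → List A → Set
  Propagates P = Linked (λ x y → P x → P y)

  Propagates⇒All : ∀ {P x xs} → Propagates P (x ∷ xs) → P x → All P (x ∷ xs)
  Propagates⇒All [-]           px = px ∷ []
  Propagates⇒All (step ∷ prop) px = px ∷ Propagates⇒All prop (step px)

  Propagates⇒last : ∀ {P y} xs → Propagates P (xs ∷ʳ y) → Any P (xs ∷ʳ y) → P y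
  Propagates⇒last []            _             (here py)         = py
  Propagates⇒last (x ∷ [])      (step ∷ [-])  (here px)         = step px
  Propagates⇒last (x ∷ [])      _             (there (here py)) = py
  Propagates⇒last (x ∷ x′ ∷ xs) (step ∷ prop) (here px)         =
    Propagates⇒last (x′ ∷ xs) prop (here (step px))
  Propagates⇒last (x ∷ x′ ∷ xs) (_ ∷ prop)    (there p)         = Propagates⇒last (x′ ∷ xs) prop p

  Propagates-closeLoop⇒All : ∀ {P} xs → Propagates P (closeLoop xs) → Any P xs → All P xs
  Propagates-closeLoop⇒All (x ∷ xs) prop p =
    ++⁻ˡ (x ∷ xs) (Propagates⇒All prop (Propagates⇒last (x ∷ xs) prop (++⁺ˡ p)))

module _ {n : ℕ} where

  sortPair : Fin n × Fin n → Fin n × Fin n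
  sortPair (a , b) with a <? b
  ... | yes _ = a , b
  ... | no _  = b , a

  sortPair-< : ∀ {i j} → i < j → sortPair (i , j) ≡ (i , j)
  sortPair-< {i} {j} i<j with i <? j
  ... | yes _   = refl
  ... | no i≮j = ⊥-elim (i≮j i<j)

  sortPair-> : ∀ {i j} → i < j → sortPair (j , i) ≡ (i , j)
  sortPair-> {i} {j} i<j with j <? i
  ... | yes j<i = ⊥-elim (<-asym i<j j<i)
  ... | no _    = refl

  sortPair-Pair : ∀ {i j a b : Fin n} → i < j → Pair i j a → Pair i j b → a ≢ b →
                  sortPair (a , b) ≡ (i , j)
  sortPair-Pair i<j a∈ b∈ a≢b with Pair-distinct a∈ b∈ a≢b
  ... | inj₁ (refl , refl) = sortPair-< i<j
  ... | inj₂ (refl , refl) = sortPair-> i<j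

  body : Hyperarc n → Fin n × Fin n
  body e = tail₁ e , tail₂ e

  Covered : (Fin n → Set) → Fin n × Fin n → Set
  Covered C (a , b) = C a × C b

  along : List (Fin n × Fin n) → List (Triple n)
  along ((a , b) ∷ (c , d) ∷ es) = (a , b , c) ∷ (a , b , d) ∷ along ((c , d) ∷ es)
  along _                        = []

  length-along : ∀ e es → length (along (e ∷ es)) ≡ 2 * length es
  length-along e []        = refl
  length-along e (e′ ∷ es) = trans (cong (2 +_) (length-along e′ es)) (sym (*-suc 2 (length es)))

  length-along-closeLoop : ∀ es → length (along (closeLoop es)) ≡ 2 * length es
  length-along-closeLoop []       = refl
  length-along-closeLoop (e ∷ es) =
    trans (length-along e (es ∷ʳ e)) (cong (2 *_) (trans (length-++ es) (+-comm (length es) 1)))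

  ∈-along⁻ : ∀ {es a b c} → (a , b , c) ∈ along es → (a , b) ∈ es
  ∈-along⁻ {(a , b) ∷ (c , d) ∷ es} (here refl)         = here refl
  ∈-along⁻ {(a , b) ∷ (c , d) ∷ es} (there (here refl)) = here refl
  ∈-along⁻ {(a , b) ∷ (c , d) ∷ es} (there (there t∈)) = there (∈-along⁻ t∈)

  along-Propagates : ∀ {C : Fin n → Set} es →
                     (∀ {a b c} → (a , b , c) ∈ along es → C a → C b → C c) →
                     Propagates (Covered C) es
  along-Propagates []                       _    = []
  along-Propagates (_ ∷ [])                 _    = [-]
  along-Propagates ((a , b) ∷ (c , d) ∷ es) step =
    (λ (ca , cb) → step (here refl) ca cb , step (there (here refl)) ca cb) ∷
    along-Propagates ((c , d) ∷ es) (step ∘ there ∘ there)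

third-vertex : ∀ {m} (i j : Fin (3 + m)) → ∃ λ w → w ≢ i × w ≢ j
third-vertex zero          zero          = suc zero , (λ ()) , (λ ())
third-vertex zero          (suc zero)    = suc (suc zero) , (λ ()) , (λ ())
third-vertex zero          (suc (suc _)) = suc zero , (λ ()) , (λ ())
third-vertex (suc zero)    zero          = suc (suc zero) , (λ ()) , (λ ())
third-vertex (suc zero)    (suc _)       = zero , (λ ()) , (λ ())
third-vertex (suc (suc _)) zero          = suc zero , (λ ()) , (λ ())
third-vertex (suc (suc _)) (suc _)       = zero , (λ ()) , (λ ())

module _ {n : ℕ} (G : Graph n) where

  edge? : Decidable (λ (p : Fin n × Fin n) → proj₁ p < proj₂ p × T (adj G (proj₁ p) (proj₂ p)))
  edge? (i , j) = (i <? j) ×-dec T? (adj G i j)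

  ∈-edges⁺ : ∀ {i j} → i < j → adj G i j ≡ true → (i , j) ∈ edges G
  ∈-edges⁺ i<j ij = ∈-filter⁺ edge? (∈-cartesianProduct⁺ (∈-allFin _) (∈-allFin _))
                              (i<j , Equivalence.from T-≡ ij)

  ∈-edges⁻ : ∀ {i j} → (i , j) ∈ edges G → i < j × adj G i j ≡ true
  ∈-edges⁻ ij∈ with ∈-filter⁻ edge? {xs = cartesianProduct (allFin n) (allFin n)} ij∈
  ... | _ , i<j , ij = i<j , Equivalence.to T-≡ ij

  edges-Unique : Unique (edges G)
  edges-Unique = filter⁺ edge? (cartesianProduct⁺ (allFin⁺ n) (allFin⁺ n))

  adj⇒∈-edges : ∀ {u v} → adj G u v ≡ true → (u , v) ∈ edges G ⊎ (v , u) ∈ edges G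
  adj⇒∈-edges {u} {v} uv with <-cmp u v
  ... | tri< u<v _ _ = inj₁ (∈-edges⁺ u<v uv)
  ... | tri≈ _ refl _ with trans (sym uv) (irrefl G u)
  ...   | ()
  adj⇒∈-edges {u} {v} uv | tri> _ _ v<u = inj₂ (∈-edges⁺ v<u (trans (Graph.sym G v u) uv))

  adj-Pair : ∀ {u v a b : Fin n} → Pair u v a → Pair u v b → a ≢ b →
             adj G a b ≡ true → adj G u v ≡ true
  adj-Pair a∈ b∈ a≢b ab with Pair-distinct a∈ b∈ a≢b
  ... | inj₁ (refl , refl) = ab
  ... | inj₂ (refl , refl) = trans (Graph.sym G _ _) ab

  edgeCount≤length : ∀ {H} → (∀ (i j : Fin n) → ∃ λ w → w ≢ i × w ≢ j) →
                     Represents H G → edgeCount G ≤ length H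
  edgeCount≤length {H} third rep =
    ≤-trans (Unique-⊆⇒length≤ edges-Unique edges⊆bodies) (≤-reflexive (length-map (sortPair ∘ body) H))
    where
    edges⊆bodies : ∀ {p} → p ∈ edges G → p ∈ map (sortPair ∘ body) H
    edges⊆bodies {i , j} ij∈ with ∈-edges⁻ ij∈ | third i j
    ... | i<j , ij | w , w≢i , w≢j with Closure-Pair⁻ (proj₁ (rep i j (<⇒≢ i<j)) ij w)
    ... | inj₁ w∈ij = ⊥-elim ([ w≢i , w≢j ]′ w∈ij)
    ... | inj₂ (e , e∈H , t₁∈ij , t₂∈ij) =
      subst (_∈ map (sortPair ∘ body) H) (sortPair-Pair i<j t₁∈ij t₂∈ij (distinct e)) (∈-map⁺ _ e∈H)

  represents-if-arcs-on-edges :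
    ∀ {H} → (∀ {e} → e ∈ H → adj G (tail₁ e) (tail₂ e) ≡ true) →
    (∀ {u v} → adj G u v ≡ true → ∀ w → Closure H (Pair u v) w) → Represents H G
  represents-if-arcs-on-edges {H} on-edges spans u v _ = spans , closed
    where
    closed : adj G u v ≡ false → ∀ w → Closure H (Pair u v) w → Pair u v w
    closed uv w c with Closure-Pair⁻ c
    ... | inj₁ w∈uv = w∈uv
    ... | inj₂ (e , e∈H , t₁∈uv , t₂∈uv)
      with trans (sym uv) (adj-Pair t₁∈uv t₂∈uv (distinct e) (on-edges e∈H))
    ...   | ()

  cyclicHypergraph : Hypergraph n
  cyclicHypergraph = arcsOf (along (closeLoop (edges G)))

  length-cyclicHypergraph : length cyclicHypergraph ≤ 2 * edgeCount G
  length-cyclicHypergraph =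
    ≤-trans (length-arcsOf (along (closeLoop (edges G)))) (≤-reflexive (length-along-closeLoop (edges G)))

  cyclic-body∈edges : ∀ {a b c} → (a , b , c) ∈ along (closeLoop (edges G)) → (a , b) ∈ edges G
  cyclic-body∈edges = ∈-closeLoop⁻ ∘ ∈-along⁻

  cyclic-chain : ∀ {S a b c} → (a , b , c) ∈ along (closeLoop (edges G)) →
                 Closure cyclicHypergraph S a → Closure cyclicHypergraph S b →
                 Closure cyclicHypergraph S c
  cyclic-chain t∈ = chain-HasArc (∈-arcsOf⁺ t∈ (<⇒≢ (proj₁ (∈-edges⁻ (cyclic-body∈edges t∈)))))

  All-Covered⇒∀ : ∀ {C} → NoIsolated G → All (Covered C) (edges G) → ∀ w → C w
  All-Covered⇒∀ no-isolated covered w with no-isolated w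
  ... | w′ , ww′ with adj⇒∈-edges ww′
  ... | inj₁ ww′∈ = proj₁ (All.lookup covered ww′∈)
  ... | inj₂ w′w∈ = proj₂ (All.lookup covered w′w∈)

  cyclic-covers : ∀ {u v} → adj G u v ≡ true →
                  All (Covered (Closure cyclicHypergraph (Pair u v))) (edges G)
  cyclic-covers {u} {v} uv =
    Propagates-closeLoop⇒All (edges G) (along-Propagates _ cyclic-chain) uv-covered
    where
    uv-covered : Any (Covered (Closure cyclicHypergraph (Pair u v))) (edges G)
    uv-covered with adj⇒∈-edges uv
    ... | inj₁ uv∈ = lose uv∈ (base (inj₁ refl) , base (inj₂ refl))
    ... | inj₂ vu∈ = lose vu∈ (base (inj₂ refl) , base (inj₁ refl))

  cyclic-represents : NoIsolated G → Represents cyclicHypergraph G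
  cyclic-represents no-isolated = represents-if-arcs-on-edges
    (λ e∈ → proj₂ (∈-edges⁻ (cyclic-body∈edges (∈-arcsOf⁻ e∈))))
    (λ uv → All-Covered⇒∀ no-isolated (cyclic-covers uv))

proposition3p1 : ∀ (n : ℕ) → 3 ≤ n → (G : Graph n) → NoIsolated G →
  ∃ λ (h : ℕ) → IsHydraNumber G h × edgeCount G ≤ h × h ≤ 2 * edgeCount G
proposition3p1 (ℕ.suc (ℕ.suc (ℕ.suc m))) (s≤s (s≤s (s≤s _))) G no-isolated
  with hydraNumber-exists G (cyclic-represents G no-isolated)
... | h , hydra@((H , rep , refl) , _) , h≤ =
  h , hydra , edgeCount≤length G third-vertex rep , ≤-trans h≤ (length-cyclicHypergraph G)
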